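{- Let $X$ and $X'$ be topological spaces, $\{Y_j\mid j\in i(X)\}$ and $\{Y'_k\mid k\in i(X')\}$ collections of topological spaces indexed by the sets of isolated points $i(X)$ and $i(X')$ respectively. Suppose $f:X\to X'$ is an onto $d$-map and, for each $j\in i(X)$, there is an onto $d$-map $f_j:Y_j\to Y'_{f(j)}$. Then there exists an onto $d$-map $g:\sum^d_{j\in X}Y_j\to\sum^d_{k\in X'}Y'_k$.
   Context: A map $f$ between topological spaces is a $d$-map if it is continuous, open, and pointwise discrete (each fibre $f^{ -1}(y)$ is a discrete subspace). $d$-sum: given a space $X$ with derivative $d_X$ (limit-point operator) and spaces $\{Y_j\mid j\in i(X)\}$, extend the collection to all $j\in X$ by $Y_j=\{j\}$ for $j\in d_X(X)$. The $d$-sum $\sum^d_{j\in X}Y_j$ has underlying set the disjoint union $Z=\bigsqcup_{j\in X}Y_j$; let $\pi:Z\to X$ send $y\in Y_j$ to $j$; its open sets are exactly the sets $V\cup\pi^{ -1}(U)$ with $V$ open in the topological sum $\bigsqcup_{j\in i(X)}Y_j$ and $U$ open in $X$. The same convention applies to $\{Y'_k\}$ over $X'$ (so $Y'_{k}=\{k\}$ for non-isolated $k$). -}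

module Defs where

open import Level using (Level; suc)
open import Data.Empty.Polymorphic using (⊥)
open import Data.Unit.Polymorphic using (⊤)
open import Data.Product using (Σ; _×_; _,_)
open import Data.Sum using (_⊎_; inj₁; inj₂)
open import Relation.Binary.PropositionalEquality using (_≡_)
open import Relation.Nullary using (¬_)

record Space (ℓ : Level) : Set (suc (suc ℓ)) where
  field
    Carrier : Set ℓ
    Open    : (Carrier → Set ℓ) → Set (suc ℓ)
open Space public

record IsTopology {ℓ} (S : Space ℓ) : Set (suc (suc ℓ)) where
  field
    open-ext : ∀ {U V : Carrier S → Set ℓ}
             → (∀ x → U x → V x) → (∀ x → V x → U x) → Open S U → Open S V
    open-all : Open S (λ _ → ⊤)
    open-∩   : ∀ {U V : Carrier S → Set ℓ}
             → Open S U → Open S V → Open S (λ x → U x × V x)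
    open-⋃   : ∀ {I : Set ℓ} (U : I → Carrier S → Set ℓ)
             → (∀ i → Open S (U i)) → Open S (λ x → Σ I (λ i → U i x))

module _ {ℓ} (A B : Space ℓ) (f : Carrier A → Carrier B) where

  Continuous : Set (suc ℓ)
  Continuous = ∀ (V : Carrier B → Set ℓ) → Open B V → Open A (λ x → V (f x))

  IsOpenMap : Set (suc ℓ)
  IsOpenMap = ∀ (U : Carrier A → Set ℓ) → Open A U
            → Open B (λ y → Σ (Carrier A) (λ x → U x × f x ≡ y))

  -- each fibre f⁻¹(y) is a discrete subspace of A: every point x of the
  -- fibre has an open U of A with U ∩ f⁻¹(y) = {x}
  PointwiseDiscrete : Set (suc ℓ)
  PointwiseDiscrete = ∀ (y : Carrier B) (x : Carrier A) → f x ≡ y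
    → Σ (Carrier A → Set ℓ) (λ U → Open A U × U x
        × (∀ x' → U x' → f x' ≡ y → x' ≡ x))

  Onto : Set ℓ
  Onto = ∀ (y : Carrier B) → Σ (Carrier A) (λ x → f x ≡ y)

  record IsDMap : Set (suc ℓ) where
    field
      continuous : Continuous
      openMap    : IsOpenMap
      discrete   : PointwiseDiscrete

  record OntoDMap : Set (suc ℓ) where
    field
      dmap : IsDMap
      onto : Onto

Isolated : ∀ {ℓ} (S : Space ℓ) → Carrier S → Set (suc ℓ)
Isolated S j = Open S (λ x → x ≡ j)

LimitPoint : ∀ {ℓ} (S : Space ℓ) → Carrier S → Set (suc ℓ)
LimitPoint S j = ¬ Isolated S j

-- d-sum.  The family Y is indexed by the subset i(X): its index is a point j
-- together with an (irrelevant) proof that j is isolated.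
module DSumDef {ℓ} (X : Space ℓ) (Y : (j : Carrier X) → .(Isolated X j) → Space ℓ) where

  record IsoPt : Set (suc ℓ) where
    constructor isoPt
    field
      idx    : Carrier X
      .isIso : Isolated X idx
      pt     : Carrier (Y idx isIso)

  -- the single point of Y_j = {j} for j ∈ d_X(X)
  record LimPt : Set (suc ℓ) where
    constructor limPt
    field
      idx    : Carrier X
      .isLim : LimitPoint X idx

  Pt : Set (suc ℓ)
  Pt = IsoPt ⊎ LimPt

  π : Pt → Carrier X
  π (inj₁ a) = IsoPt.idx a
  π (inj₂ b) = LimPt.idx b

  -- open sets of the topological sum ⊔_{j ∈ i(X)} Y_j: every slice is open
  -- (the slice is a predicate one level up, so "open" means: equal, as a
  -- subset, to an open set of Y_j)
  SumOpen : (IsoPt → Set (suc ℓ)) → Set (suc ℓ)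
  SumOpen V = (j : Carrier X) → .(p : Isolated X j)
            → Σ (Carrier (Y j p) → Set ℓ) (λ O → Open (Y j p) O
                × (∀ y → O y → V (isoPt j p y))
                × (∀ y → V (isoPt j p y) → O y))

  extend : (IsoPt → Set (suc ℓ)) → Pt → Set (suc ℓ)
  extend V (inj₁ a) = V a
  extend V (inj₂ _) = ⊥

  DOpen : (Pt → Set (suc ℓ)) → Set (suc (suc ℓ))
  DOpen W = Σ (IsoPt → Set (suc ℓ)) (λ V → Σ (Carrier X → Set ℓ) (λ U →
              SumOpen V × Open X U
              × (∀ z → W z → extend V z ⊎ U (π z))
              × (∀ z → extend V z ⊎ U (π z) → W z)))

DSum : ∀ {ℓ} (X : Space ℓ) → ((j : Carrier X) → .(Isolated X j) → Space ℓ)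
     → Space (suc ℓ)
DSum X Y = record { Carrier = DSumDef.Pt X Y ; Open = DSumDef.DOpen X Y }

module Submission where

-- The d-map g between the d-sums acts by f on the index and by
-- f_j inside each summand:  g(y) = f_j(y) ∈ Y'_{f(j)} for y ∈ Y_j, j ∈ i(X),
-- and g(j) = f(j) for a limit point j.  This is well defined because a d-map
-- preserves isolated points (it is open, so the image of the open {j} is the
-- open {f(j)}) and reflects them (f⁻¹{f(j)} is open by continuity and meets
-- a neighbourhood of j only in j by discreteness of the fibre).

open import Defs
open import Level using (Level) renaming (suc to lsuc)
open import Data.Product using (Σ; _×_; _,_; proj₁; proj₂)
open import Data.Sum using (_⊎_; inj₁; inj₂)
open import Data.Empty.Polymorphic using (⊥)
open import Relation.Binary.PropositionalEquality using (_≡_; refl; cong)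

empty-open : ∀ {ℓ} {Z : Space ℓ} → IsTopology Z → Open Z (λ _ → ⊥)
empty-open TZ = open-ext (λ { x (() , _) }) (λ x ())
                         (open-⋃ {I = ⊥} (λ ()) (λ ()))
  where open IsTopology TZ

module _ {ℓ} {A B : Space ℓ} {f : Carrier A → Carrier B} where

  -- An open map sends an isolated point to an isolated point: f({j}) = {f(j)}.
  open-preserves-isolated : IsTopology B → IsOpenMap A B f
    → ∀ j → Isolated A j → Isolated B (f j)
  open-preserves-isolated TB fopen j p =
    open-ext (λ { y (x , refl , refl) → refl }) (λ { y refl → j , refl , refl })
             (fopen (λ x → x ≡ j) p)
    where open IsTopology TB

  -- A continuous map with discrete fibres reflects isolated points: if U is
  -- an open neighbourhood of j meeting f⁻¹{f(j)} only in j, then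
  -- {j} = U ∩ f⁻¹{f(j)} is open.
  discrete-reflects-isolated : IsTopology A → Continuous A B f → PointwiseDiscrete A B f
    → ∀ j → Isolated B (f j) → Isolated A j
  discrete-reflects-isolated TA fcont fdisc j q with fdisc (f j) j refl
  ... | U , U-open , j∈U , U∩fibre⊆j =
    open-ext (λ x x∈ → U∩fibre⊆j x (proj₁ x∈) (proj₂ x∈)) (λ { x refl → j∈U , refl })
             (open-∩ U-open (fcont (λ y → y ≡ f j) q))
    where open IsTopology TA

union-dOpen : ∀ {ℓ} (X : Space ℓ) (Y : (j : Carrier X) → .(Isolated X j) → Space ℓ)
  → let open DSumDef X Y in
    ∀ {V U} → SumOpen V → Open X U → DOpen (λ z → extend V z ⊎ U (π z))
union-dOpen X Y {V} {U} V-open U-open = V , U , V-open , U-open , (λ z w → w) , (λ z w → w)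

module SumOpens {ℓ} (X : Space ℓ) (Y : (j : Carrier X) → .(Isolated X j) → Space ℓ)
  (TY : (j : Carrier X) → .(p : Isolated X j) → IsTopology (Y j p)) where

  open DSumDef X Y
  open IsTopology

  nothing : IsoPt → Set (lsuc ℓ)
  nothing _ = ⊥

  nothing-sumOpen : SumOpen nothing
  nothing-sumOpen j p = (λ _ → ⊥) , empty-open (TY j p) , (λ y ()) , (λ y ())

  inSummand : (j : Carrier X) .(p : Isolated X j) → (Carrier (Y j p) → Set ℓ) → IsoPt → Set (lsuc ℓ)
  inSummand j p O a = Σ (Carrier (Y j p)) (λ y → O y × a ≡ isoPt j p y)

  -- If O is open in Y_j then it is open in the sum: its slice at j' is the
  -- union over the (at most one) proof of j' ≡ j of O transported to Y_j'.
  inSummand-sumOpen : (j : Carrier X) .(p : Isolated X j) (O : Carrier (Y j p) → Set ℓ)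
    → Open (Y j p) O → SumOpen (inSummand j p O)
  inSummand-sumOpen j p O O-open j' p' =
      (λ y → Σ (j' ≡ j) (λ e → O-at j' p' e y))
    , open-⋃ (TY j' p') (O-at j' p') (O-at-open j' p')
    , (λ { y (refl , o) → y , o , refl })
    , (λ { y (.y , o , refl) → refl , o })
    where
    O-at : (j' : Carrier X) .(p' : Isolated X j') → j' ≡ j → Carrier (Y j' p') → Set ℓ
    O-at .j p' refl = O
    O-at-open : (j' : Carrier X) .(p' : Isolated X j') (e : j' ≡ j) → Open (Y j' p') (O-at j' p' e)
    O-at-open .j p' refl = O-open

module DSumMap {ℓ} {X X' : Space ℓ}
  {Y : (j : Carrier X) → .(Isolated X j) → Space ℓ}
  {Y' : (k : Carrier X') → .(Isolated X' k) → Space ℓ}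
  (f : Carrier X → Carrier X')
  (preserve : ∀ j → Isolated X j → Isolated X' (f j))
  (reflect : ∀ j → Isolated X' (f j) → Isolated X j)
  (h : (j : Carrier X) → .(p : Isolated X j) → Carrier (Y j p) → Carrier (Y' (f j) (preserve j p)))
  where

  module S = DSumDef X Y
  module T = DSumDef X' Y'

  onSummands : S.IsoPt → T.IsoPt
  onSummands (S.isoPt j p y) = T.isoPt (f j) (preserve j p) (h j p y)

  -- A limit point j goes to f(j), a limit point of X' since f reflects isolation.
  g : S.Pt → T.Pt
  g (inj₁ a) = inj₁ (onSummands a)
  g (inj₂ (S.limPt j l)) = inj₂ (T.limPt (f j) (λ q → l (reflect j q)))

  π-g : ∀ z → f (S.π z) ≡ T.π (g z)
  π-g (inj₁ _) = refl
  π-g (inj₂ _) = refl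

  g-onto : Onto X X' f → (∀ j .p → Onto (Y j p) (Y' (f j) (preserve j p)) (h j p))
    → Onto (DSum X Y) (DSum X' Y') g
  g-onto f-onto h-onto (inj₁ (T.isoPt k q y')) with f-onto k
  ... | j , refl with h-onto j (reflect j q) y'
  ...   | y , refl = inj₁ (S.isoPt j (reflect j q) y) , refl
  g-onto f-onto h-onto (inj₂ (T.limPt k l)) with f-onto k
  ... | j , refl = inj₂ (S.limPt j (λ p → l (preserve j p))) , refl

  -- The preimage of V' ∪ π⁻¹(U') is onSummands⁻¹(V') ∪ π⁻¹(f⁻¹(U')).
  g-continuous : Continuous X X' f → (∀ j .p → Continuous (Y j p) (Y' (f j) (preserve j p)) (h j p))
    → Continuous (DSum X Y) (DSum X' Y') g
  g-continuous f-cont h-cont W (V' , U' , V'-open , U'-open , W⊆ , ⊆W) =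
    (λ a → V' (onSummands a)) , (λ x → U' (f x)) , V-open , f-cont U' U'-open , W⊆' , ⊆W'
    where
    V-open : S.SumOpen (λ a → V' (onSummands a))
    V-open j p with V'-open (f j) (preserve j p)
    ... | O' , O'-open , O'⊆ , ⊆O' =
      (λ y → O' (h j p y)) , h-cont j p O' O'-open , (λ y → O'⊆ (h j p y)) , (λ y → ⊆O' (h j p y))
    W⊆' : ∀ z → W (g z) → S.extend (λ a → V' (onSummands a)) z ⊎ U' (f (S.π z))
    W⊆' (inj₁ a) = W⊆ (g (inj₁ a))
    W⊆' (inj₂ b) = W⊆ (g (inj₂ b))
    ⊆W' : ∀ z → S.extend (λ a → V' (onSummands a)) z ⊎ U' (f (S.π z)) → W (g z)
    ⊆W' (inj₁ a) = ⊆W (g (inj₁ a))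
    ⊆W' (inj₂ b) = ⊆W (g (inj₂ b))

  -- The image of V under onSummands is open in the target sum: its slice at k is the
  -- union, over j with f(j) = k, of the images h_j(V ∩ Y_j).
  image-sumOpen : (∀ k .q → IsTopology (Y' k q))
    → (∀ j .p → IsOpenMap (Y j p) (Y' (f j) (preserve j p)) (h j p))
    → ∀ {V} → S.SumOpen V → T.SumOpen (λ b → Σ S.IsoPt (λ a → V a × onSummands a ≡ b))
  image-sumOpen TY' h-open {V} V-open k q =
      (λ y' → Σ (Σ (Carrier X) (λ j → f j ≡ k)) (λ je → image (proj₁ je) (proj₂ je) y'))
    , IsTopology.open-⋃ (TY' k q) (λ je → image (proj₁ je) (proj₂ je))
                                   (λ je → image-open (proj₁ je) (proj₂ je))
    , image⊆ , ⊆image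
    where
    slice : (j : Carrier X) .(p : Isolated X j) → Carrier (Y j p) → Set ℓ
    slice j p = proj₁ (V-open j p)
    image : (j : Carrier X) → f j ≡ k → Carrier (Y' k q) → Set ℓ
    image j refl y' = Σ (Carrier (Y j (reflect j q))) (λ y → slice j (reflect j q) y × h j (reflect j q) y ≡ y')
    image-open : (j : Carrier X) (e : f j ≡ k) → Open (Y' k q) (image j e)
    image-open j refl = h-open j (reflect j q) (slice j (reflect j q)) (proj₁ (proj₂ (V-open j (reflect j q))))
    image⊆ : ∀ y' → Σ (Σ (Carrier X) (λ j → f j ≡ k)) (λ je → image (proj₁ je) (proj₂ je) y')
      → Σ S.IsoPt (λ a → V a × onSummands a ≡ T.isoPt k q y')
    image⊆ y' ((j , refl) , y , y∈ , refl) =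
      S.isoPt j (reflect j q) y , proj₁ (proj₂ (proj₂ (V-open j (reflect j q)))) y y∈ , refl
    ⊆image : ∀ y' → Σ S.IsoPt (λ a → V a × onSummands a ≡ T.isoPt k q y')
      → Σ (Σ (Carrier X) (λ j → f j ≡ k)) (λ je → image (proj₁ je) (proj₂ je) y')
    ⊆image y' (S.isoPt j p y , v , refl) = (j , refl) , y , proj₂ (proj₂ (proj₂ (V-open j p))) y v , refl

  -- The image of V ∪ π⁻¹(U) is onSummands(V) ∪ π⁻¹(f(U)); for the second part every
  -- point over f(U) must be hit, which uses that the h_j are onto.
  g-open : (∀ k .q → IsTopology (Y' k q))
    → IsOpenMap X X' f
    → (∀ j .p → IsOpenMap (Y j p) (Y' (f j) (preserve j p)) (h j p))
    → (∀ j .p → Onto (Y j p) (Y' (f j) (preserve j p)) (h j p))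
    → IsOpenMap (DSum X Y) (DSum X' Y') g
  g-open TY' f-open h-open h-onto W (V , U , V-open , U-open , W⊆ , ⊆W) =
    V' , U' , image-sumOpen TY' h-open V-open , f-open U U-open , gW⊆ , ⊆gW
    where
    U' : Carrier X' → Set ℓ
    U' k = Σ (Carrier X) (λ x → U x × f x ≡ k)
    V' : T.IsoPt → Set (lsuc ℓ)
    V' b = Σ S.IsoPt (λ a → V a × onSummands a ≡ b)
    gW⊆ : ∀ z' → Σ S.Pt (λ z → W z × g z ≡ z') → T.extend V' z' ⊎ U' (T.π z')
    gW⊆ .(g z) (z , w , refl) = image-of-piece z (W⊆ z w)
      where
      image-of-piece : ∀ z → S.extend V z ⊎ U (S.π z) → T.extend V' (g z) ⊎ U' (T.π (g z))
      image-of-piece (inj₁ a) (inj₁ v) = inj₁ (a , v , refl)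
      image-of-piece z (inj₂ u) = inj₂ (S.π z , u , π-g z)
    ⊆gW : ∀ z' → T.extend V' z' ⊎ U' (T.π z') → Σ S.Pt (λ z → W z × g z ≡ z')
    ⊆gW (inj₁ b) (inj₁ (a , v , e)) = inj₁ a , ⊆W (inj₁ a) (inj₁ v) , cong inj₁ e
    ⊆gW (inj₁ (T.isoPt .(f x) q y')) (inj₂ (x , u , refl)) with h-onto x (reflect x q) y'
    ... | y , refl = inj₁ (S.isoPt x (reflect x q) y) , ⊆W _ (inj₂ u) , refl
    ⊆gW (inj₂ (T.limPt .(f x) l)) (inj₂ (x , u , refl)) =
      inj₂ (S.limPt x (λ p → l (preserve x p))) , ⊆W _ (inj₂ u) , refl

  inj₁-isoPt-injective : ∀ {k} .{q : Isolated X' k} {a b : Carrier (Y' k q)}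
    → _≡_ {A = T.Pt} (inj₁ (T.isoPt k q a)) (inj₁ (T.isoPt k q b)) → a ≡ b
  inj₁-isoPt-injective refl = refl

  -- A point y ∈ Y_j is isolated in its fibre by a neighbourhood O ⊆ Y_j that
  -- isolates y in the fibre of h_j.  A limit point j is isolated by π⁻¹(U),
  -- where U isolates j in the fibre of f: the fibre of g over a limit point
  -- of X' contains only limit points, and π is injective on those.
  g-discrete : IsTopology X → (∀ j .p → IsTopology (Y j p))
    → PointwiseDiscrete X X' f
    → (∀ j .p → PointwiseDiscrete (Y j p) (Y' (f j) (preserve j p)) (h j p))
    → PointwiseDiscrete (DSum X Y) (DSum X' Y') g
  g-discrete TX TY f-disc h-disc .(g z) z refl = separate z
    where
    open SumOpens X Y TY
    separate : ∀ z → Σ (S.Pt → Set (lsuc ℓ)) (λ W → S.DOpen W × W z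
                       × (∀ z' → W z' → g z' ≡ g z → z' ≡ z))
    separate (inj₁ (S.isoPt j p y)) with h-disc j p (h j p y) y refl
    ... | O , O-open , y∈O , O∩fibre⊆y =
        (λ z → S.extend (inSummand j p O) z ⊎ ⊥)
      , union-dOpen X Y (inSummand-sumOpen j p O O-open) (empty-open TX)
      , inj₁ (y , y∈O , refl)
      , fibre
      where
      fibre : ∀ z' → S.extend (inSummand j p O) z' ⊎ ⊥ → g z' ≡ g (inj₁ (S.isoPt j p y))
            → z' ≡ inj₁ (S.isoPt j p y)
      fibre (inj₁ .(S.isoPt j p y₀)) (inj₁ (y₀ , y₀∈O , refl)) e
        with O∩fibre⊆y y₀ y₀∈O (inj₁-isoPt-injective e)
      ... | refl = refl
    separate (inj₂ (S.limPt j l)) with f-disc (f j) j refl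
    ... | U , U-open , j∈U , U∩fibre⊆j =
        (λ z → S.extend nothing z ⊎ U (S.π z))
      , union-dOpen X Y nothing-sumOpen U-open
      , inj₂ j∈U
      , fibre
      where
      fibre : ∀ z' → S.extend nothing z' ⊎ U (S.π z') → g z' ≡ g (inj₂ (S.limPt j l))
            → z' ≡ inj₂ (S.limPt j l)
      fibre (inj₂ (S.limPt j' l')) (inj₂ u) e with U∩fibre⊆j j' u (cong T.π e)
      ... | refl = refl

mainTheorem17 : {ℓ : Level} (X X' : Space ℓ) → IsTopology X → IsTopology X'
    → (Y : (j : Carrier X) → .(Isolated X j) → Space ℓ)
    → (Y' : (k : Carrier X') → .(Isolated X' k) → Space ℓ)
    → ((j : Carrier X) → .(p : Isolated X j) → IsTopology (Y j p))
    → ((k : Carrier X') → .(q : Isolated X' k) → IsTopology (Y' k q))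
    → (f : Carrier X → Carrier X') → OntoDMap X X' f
    → ((j : Carrier X) → .(p : Isolated X j) → .(q : Isolated X' (f j))
    → Σ (Carrier (Y j p) → Carrier (Y' (f j) q)) (OntoDMap (Y j p) (Y' (f j) q)))
    → Σ (Carrier (DSum X Y) → Carrier (DSum X' Y'))
    (OntoDMap (DSum X Y) (DSum X' Y'))
mainTheorem17 X X' TX TX' Y Y' TY TY' f f-dmap F =
  g , record { dmap = record { continuous = g-continuous f-cont (λ j p → continuous (dmap (fⱼ j p)))
                             ; openMap    = g-open TY' f-open (λ j p → openMap (dmap (fⱼ j p)))
                                                              (λ j p → onto (fⱼ j p))
                             ; discrete   = g-discrete TX TY f-disc (λ j p → discrete (dmap (fⱼ j p))) }
             ; onto = g-onto (onto f-dmap) (λ j p → onto (fⱼ j p)) }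
  where
  open OntoDMap
  open IsDMap
  f-cont : Continuous X X' f
  f-cont = continuous (dmap f-dmap)
  f-open : IsOpenMap X X' f
  f-open = openMap (dmap f-dmap)
  f-disc : PointwiseDiscrete X X' f
  f-disc = discrete (dmap f-dmap)
  preserve : ∀ j → Isolated X j → Isolated X' (f j)
  preserve = open-preserves-isolated TX' f-open
  reflect : ∀ j → Isolated X' (f j) → Isolated X j
  reflect = discrete-reflects-isolated TX f-cont f-disc
  fⱼ : (j : Carrier X) .(p : Isolated X j) → OntoDMap (Y j p) (Y' (f j) (preserve j p)) (proj₁ (F j p (preserve j p)))
  fⱼ j p = proj₂ (F j p (preserve j p))
  open DSumMap {X = X} {X'} {Y} {Y'} f preserve reflect (λ j p → proj₁ (F j p (preserve j p)))
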